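{- The next symbol relation $R_{\mathsf{Next}}=\{(x,y)\in D^2 : x\leadsto_w y\}$ can be maintained in $\mathsf{DynCQ}$.
   Context: Dynamic setting. Fix a finite alphabet $\Sigma$. A word-structure has domain $D=\{1,\dots,n+1\}$ ($n\ge0$), the linear order $<$, a constant $\$=n+1$, and for each $\zeta\in\Sigma$ a unary relation $R_\zeta\subseteq\{1,\dots,n\}$, each position in at most one $R_\zeta$. Write $w(i)=\zeta$ if $R_\zeta(i)$ and $w(i)=\varepsilon$ otherwise; the word is $w=w(1)\cdots w(n)$. Symbol-elements are positions with $w(i)\neq\varepsilon$; $\mathrm{pos}_w(x)$ is the number of symbol-elements $\le x$. For $x,y\in D$, $x\leadsto_w y$ means that $x,y$ are symbol-elements with $\mathrm{pos}_w(y)=\mathrm{pos}_w(x)+1$. Updates $\mathsf{ins}_\zeta(i)$ (set $w(i)=\zeta$) and $\mathsf{reset}(i)$ (set $w(i)=\varepsilon$), $i\le n$, are allowed only if they change the word-structure; initially all positions are $\varepsilon$. A dynamic program has finitely many auxiliary relations over $D$, initialized by first-order formulas, and for each auxiliary relation $R$ (arity $k$) and each abstract update $\mathsf{op}$ an update formula $\varphi^R_{\mathsf{op}}(y;x_1,\dots,x_k)$; after applying $\mathsf{op}$ at $i$, the new $R$ is the set of $\vec j$ with $\varphi^R_{\mathsf{op}}(i;\vec j)$ true in the updated word-structure with the old auxiliary relations. A program maintains a relation if a designated auxiliary relation equals it after every sequence of updates. $\mathsf{DynCQ}$: all update formulas are conjunctive queries (built from atoms by conjunction and existential quantification). -}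

module Defs where

open import Data.Nat using (ℕ; zero; suc; _+_)
open import Data.Bool using (Bool; true; false; _∧_; _∨_; not; if_then_else_; T)
open import Data.Maybe using (Maybe; just; nothing; is-just)
open import Data.Fin using (Fin; zero; suc; fromℕ; inject₁; toℕ) renaming (_≟_ to _≟ᶠ_)
open import Data.Nat using (_<ᵇ_; _≤ᵇ_) renaming (_≟_ to _≟ⁿ_)
open import Data.Vec using (Vec; []; _∷_; replicate; map; lookup; _[_]≔_)
open import Data.List using (List; []; _∷_; allFin) renaming (map to mapL)
open import Data.Nat.ListAction using (sum)
open import Data.Bool.ListAction using () renaming (any to anyL; all to allL)
open import Data.Product using (Σ; _×_; _,_; proj₁; proj₂)
open import Data.Empty using (⊥)
open import Data.Unit using (⊤)
open import Relation.Nullary using (¬_)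
open import Relation.Nullary.Decidable using (⌊_⌋)
open import Relation.Binary.PropositionalEquality using (_≡_; _≢_; subst; sym)
open import Function.Bundles using (_⇔_)

-- A word-structure with domain {1,…,n+1} is
-- represented with domain Fin (suc n): element j stands for position j+1,
-- the constant $ is the last element (fromℕ n), < is the order of Fin.
-- The letters at positions 1..n are stored in a Vec (Maybe (Fin k)) n;
-- nothing = ε.  The element $ never carries a symbol.

Dom : ℕ → Set
Dom n = Fin (suc n)

Word : ℕ → ℕ → Set
Word k n = Vec (Maybe (Fin k)) n

letter : ∀ {k n} → Word k n → Dom n → Maybe (Fin k)
letter [] _ = nothing
letter (a ∷ as) zero = a
letter (a ∷ as) (suc i) = letter as i

dollar : ∀ n → Dom n
dollar n = fromℕ n

IsSymbol : ∀ {k n} → Word k n → Dom n → Set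
IsSymbol w x = letter w x ≢ nothing

pos : ∀ {k n} → Word k n → Dom n → ℕ
pos {n = n} w x =
  sum (mapL (λ j → if (toℕ j ≤ᵇ toℕ x) ∧ is-just (letter w j) then 1 else 0)
            (allFin (suc n)))

Next : ∀ {k n} → Word k n → Dom n → Dom n → Set
Next w x y = IsSymbol w x × IsSymbol w y × (pos w y ≡ suc (pos w x))

-- A relational vocabulary for auxiliary relations: `Rel a` is the set of
-- auxiliary relation symbols of arity a.

data Term (v : ℕ) : Set where
  var : Fin v → Term v
  cdollar : Term v

data Atom (k : ℕ) (Rel : ℕ → Set) (v : ℕ) : Set where
  eqA  : Term v → Term v → Atom k Rel v
  ltA  : Term v → Term v → Atom k Rel v
  symA : Fin k → Term v → Atom k Rel v
  auxA : ∀ {a} → Rel a → Vec (Term v) a → Atom k Rel v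

data FO (k : ℕ) (Rel : ℕ → Set) : ℕ → Set where
  atom : ∀ {v} → Atom k Rel v → FO k Rel v
  neg  : ∀ {v} → FO k Rel v → FO k Rel v
  and  : ∀ {v} → FO k Rel v → FO k Rel v → FO k Rel v
  or   : ∀ {v} → FO k Rel v → FO k Rel v → FO k Rel v
  ex   : ∀ {v} → FO k Rel (suc v) → FO k Rel v
  all  : ∀ {v} → FO k Rel (suc v) → FO k Rel v

data CQ (k : ℕ) (Rel : ℕ → Set) : ℕ → Set where
  atom : ∀ {v} → Atom k Rel v → CQ k Rel v
  and  : ∀ {v} → CQ k Rel v → CQ k Rel v → CQ k Rel v
  ex   : ∀ {v} → CQ k Rel (suc v) → CQ k Rel v

NoRel : ℕ → Set
NoRel _ = ⊥

Interp : (ℕ → Set) → ℕ → Set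
Interp Rel n = ∀ {a} → Rel a → Vec (Dom n) a → Bool

evalTerm : ∀ {n v} → (Fin v → Dom n) → Term v → Dom n
evalTerm ρ (var i) = ρ i
evalTerm {n} ρ cdollar = dollar n

sameLetter : ∀ {k} → Maybe (Fin k) → Fin k → Bool
sameLetter nothing _ = false
sameLetter (just a) z = ⌊ a ≟ᶠ z ⌋

evalAtom : ∀ {k Rel n v} → Word k n → Interp Rel n → (Fin v → Dom n) → Atom k Rel v → Bool
evalAtom w I ρ (eqA s t) = ⌊ evalTerm ρ s ≟ᶠ evalTerm ρ t ⌋
evalAtom w I ρ (ltA s t) = toℕ (evalTerm ρ s) <ᵇ toℕ (evalTerm ρ t)
evalAtom w I ρ (symA z t) = sameLetter (letter w (evalTerm ρ t)) z
evalAtom w I ρ (auxA r ts) = I r (map (evalTerm ρ) ts)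

extend : ∀ {n v} → Dom n → (Fin v → Dom n) → Fin (suc v) → Dom n
extend d ρ zero = d
extend d ρ (suc i) = ρ i

evalFO : ∀ {k Rel n v} → Word k n → Interp Rel n → (Fin v → Dom n) → FO k Rel v → Bool
evalFO w I ρ (atom α) = evalAtom w I ρ α
evalFO w I ρ (neg φ) = not (evalFO w I ρ φ)
evalFO w I ρ (and φ ψ) = evalFO w I ρ φ ∧ evalFO w I ρ ψ
evalFO w I ρ (or φ ψ) = evalFO w I ρ φ ∨ evalFO w I ρ ψ
evalFO {n = n} w I ρ (ex φ) = anyL (λ d → evalFO w I (extend d ρ) φ) (allFin (suc n))
evalFO {n = n} w I ρ (all φ) = allL (λ d → evalFO w I (extend d ρ) φ) (allFin (suc n))

evalCQ : ∀ {k Rel n v} → Word k n → Interp Rel n → (Fin v → Dom n) → CQ k Rel v → Bool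
evalCQ w I ρ (atom α) = evalAtom w I ρ α
evalCQ w I ρ (and φ ψ) = evalCQ w I ρ φ ∧ evalCQ w I ρ ψ
evalCQ {n = n} w I ρ (ex φ) = anyL (λ d → evalCQ w I (extend d ρ) φ) (allFin (suc n))

noInterp : ∀ {n} → Interp NoRel n
noInterp ()

data Op (k : ℕ) : Set where
  insOp   : Fin k → Op k
  resetOp : Op k

data Update (k n : ℕ) : Set where
  ins   : Fin k → Fin n → Update k n
  reset : Fin n → Update k n

opOf : ∀ {k n} → Update k n → Op k
opOf (ins z i) = insOp z
opOf (reset i) = resetOp

argOf : ∀ {k n} → Update k n → Dom n
argOf (ins z i) = inject₁ i
argOf (reset i) = inject₁ i

applyWord : ∀ {k n} → Update k n → Word k n → Word k n
applyWord (ins z i) w = w [ i ]≔ just z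
applyWord (reset i) w = w [ i ]≔ nothing

Allowed : ∀ {k n} → Word k n → Update k n → Set
Allowed w u = applyWord u w ≢ w

emptyWord : ∀ {k} n → Word k n
emptyWord n = replicate n nothing

-- Dynamic programs with CQ update formulas (DynCQ programs).
-- m auxiliary relations with arities `arity`; an update formula for
-- relation r of arity a under abstract update op has a+1 free variables:
-- variable 0 is the update parameter y, variables 1..a are x_1..x_a.

RelOf : ∀ {m} → (Fin m → ℕ) → ℕ → Set
RelOf {m} arity a = Σ (Fin m) (λ r → arity r ≡ a)

record DynCQProgram (k : ℕ) : Set where
  field
    m      : ℕ
    arity  : Fin m → ℕ
    init   : (r : Fin m) → FO k NoRel (arity r)
    update : (r : Fin m) → Op k → CQ k (RelOf arity) (suc (arity r))

module _ {k : ℕ} (P : DynCQProgram k) where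
  open DynCQProgram P

  AuxState : ℕ → Set
  AuxState n = (r : Fin m) → Vec (Dom n) (arity r) → Bool

  asInterp : ∀ {n} → AuxState n → Interp (RelOf arity) n
  asInterp {n} S (r , p) t = S r (subst (Vec (Dom n)) (sym p) t)

  State : ℕ → Set
  State n = Word k n × AuxState n

  initState : ∀ n → State n
  initState n = emptyWord n ,
    (λ r t → evalFO (emptyWord n) noInterp (lookup t) (init r))

  -- apply a concrete update: the update formulas are evaluated in the
  -- updated word-structure with the old auxiliary relations
  step : ∀ {n} → State n → Update k n → State n
  step (w , S) u = w' , (λ r t →
      evalCQ w' (asInterp S) (extend (argOf u) (lookup t)) (update r (opOf u)))
    where
    w' = applyWord u w

  run : ∀ {n} → State n → List (Update k n) → State n
  run s [] = s
  run s (u ∷ us) = run (step s u) us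

  AllowedSeq : ∀ {n} → Word k n → List (Update k n) → Set
  AllowedSeq w [] = ⊤
  AllowedSeq w (u ∷ us) = Allowed w u × AllowedSeq (applyWord u w) us

  MaintainsNext : (r : Fin m) → arity r ≡ 2 → Set
  MaintainsNext r p = ∀ n (us : List (Update k n)) → AllowedSeq (emptyWord n) us →
    let s = run (initState n) us in
    ∀ (x y : Dom n) →
      T (asInterp (proj₂ s) (r , p) (x ∷ y ∷ [])) ⇔ Next (proj₁ s) x y

-- Next(x, y) is equivalent to x < y ∧ SymbolOrEq(x, y) ∧ SymbolOrEq(y, x) ∧ Gap(x, y), where
-- SymbolOrEq(x, z) says that x is a symbol or x = z, and Gap(a, b) that no symbol lies strictly
-- between a and b. Both are maintained by conjunctive queries, because the disjunctions and
-- inequalities they need are provided by three static relations NotBetween(a, c, b) = ¬(a < c < b),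
-- EqEither(u, c, z) = (u = c ∨ u = z) and NeqOrEq(x, c, z) = (x ≠ c ∨ x = z), which are set up by the
-- first-order initialisation and never change. After writing a symbol at c, Gap(a, b) survives iff
-- ¬(a < c < b), and x becomes a symbol iff it was one or x = c. After erasing c, Gap(a, b) holds iff
-- Gap(a, p) ∧ Gap(p, b) for some p ∈ {a, c}, and a symbol x remains one iff x ≠ c.
-- Correctness is the invariant that every auxiliary relation is the intended one; it is checked against
-- a set-valued semantics of formulas, to which the Boolean evaluation is sound.

module Submission where

open import Defs
open import Data.Bool using (Bool; true; false; not; _∧_; if_then_else_; T)
open import Data.Bool.ListAction as ListAction using (any)
open import Data.Bool.Properties using (T-∧; T-∨)
open import Data.Fin using (Fin; zero; suc; toℕ; inject₁; _≤_; _<_; _<?_) renaming (_≟_ to _≟ᶠ_)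
open import Data.Fin.Properties using (<-cmp; <-trans; <-asym; <-irrefl; <⇒≢; suc-injective)
open import Data.List using (List; []; _∷_; allFin; tabulate)
open import Data.List.Properties using (map-tabulate; tabulate-cong)
open import Data.List.Relation.Unary.All.Properties as All using (all⁺; all⁻)
open import Data.List.Relation.Unary.Any.Properties as Any using (any⁺; any⁻)
open import Data.Maybe using (Maybe; just; nothing; is-just)
open import Data.Maybe.Properties using (just-injective)
open import Data.Nat using (ℕ; suc; _+_; _≤ᵇ_; z≤n) renaming (_≤_ to _≤ℕ_; _<_ to _<ℕ_)
open import Data.Nat.ListAction using (sum)
open import Data.Nat.Properties
  using (<ᵇ⇒<; <⇒<ᵇ; ≤ᵇ-reflects-≤; ≤-refl; ≤-reflexive; ≤-trans; +-mono-≤; +-mono-<-≤; +-mono-≤-<;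
         +-suc; ≤-pred; ≰⇒>; <⇒≱; <⇒≤)
  renaming (_≤?_ to _≤ℕ?_)
open import Data.Product using (Σ; ∃; _×_; _,_; uncurry)
open import Data.Product.Function.Dependent.Propositional using (Σ-⇔)
open import Data.Product.Function.NonDependent.Propositional using (_×-⇔_)
open import Data.Sum using (_⊎_; inj₁; inj₂; [_,_])
open import Data.Sum.Function.Propositional using (_⊎-⇔_)
open import Data.Vec using (Vec; []; _∷_; map; lookup; _[_]≔_) renaming (tabulate to tabulateᵛ)
open import Function using (id; _∘_; _⇔_; mk⇔; Equivalence)
open import Function.Construct.Composition using (_⇔-∘_)
open import Function.Construct.Identity using (↠-id; ⇔-id)
open import Function.Construct.Symmetry using (⇔-sym)
open import Function.Related.TypeIsomorphisms using (¬-cong-⇔)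
open import Relation.Binary.Definitions using (tri<; tri≈; tri>)
open import Relation.Binary.PropositionalEquality
  using (_≡_; _≢_; refl; cong; cong₂; sym; trans; subst; ≢-sym)
open import Relation.Nullary using (¬_; contradiction; yes; no)
open import Relation.Nullary.Decidable using (toWitness; fromWitness; _×-dec_)
open import Relation.Nullary.Reflects using (ofʸ; ofⁿ)

variable
  k n v : ℕ

-- Boolean evaluation versus set-valued semantics

T-not : ∀ {b} → T (not b) ⇔ (¬ T b)
T-not {true} = mk⇔ (λ ()) (λ f → f _)
T-not {false} = mk⇔ (λ _ ()) _

T-any-allFin : (p : Fin n → Bool) → T (any p (allFin n)) ⇔ ∃ (T ∘ p)
T-any-allFin p = mk⇔ (Any.tabulate⁻ ∘ any⁻ p _) (any⁺ p ∘ uncurry Any.tabulate⁺)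

T-all-allFin : (p : Fin n → Bool) → T (ListAction.all p (allFin n)) ⇔ (∀ i → T (p i))
T-all-allFin p = mk⇔ (All.tabulate⁻ ∘ all⁺ p _) (all⁻ p ∘ All.tabulate⁺)

∀-cong-⇔ : {A B : Fin n → Set} → (∀ i → A i ⇔ B i) → (∀ i → A i) ⇔ (∀ i → B i)
∀-cong-⇔ A⇔B = mk⇔ (λ f i → Equivalence.to (A⇔B i) (f i)) (λ f i → Equivalence.from (A⇔B i) (f i))

RelSemantics : (ℕ → Set) → ℕ → Set₁
RelSemantics Rel n = ∀ {a} → Rel a → Vec (Dom n) a → Set

module Semantics {Rel : ℕ → Set} (w : Word k n) (M : RelSemantics Rel n) where

  ⟦_⟧ᵃ : Atom k Rel v → (Fin v → Dom n) → Set
  ⟦ eqA s t ⟧ᵃ ρ = evalTerm ρ s ≡ evalTerm ρ t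
  ⟦ ltA s t ⟧ᵃ ρ = evalTerm ρ s < evalTerm ρ t
  ⟦ symA ζ t ⟧ᵃ ρ = letter w (evalTerm ρ t) ≡ just ζ
  ⟦ auxA r ts ⟧ᵃ ρ = M r (map (evalTerm ρ) ts)

  ⟦_⟧ᶜ : CQ k Rel v → (Fin v → Dom n) → Set
  ⟦ atom α ⟧ᶜ = ⟦ α ⟧ᵃ
  ⟦ and φ ψ ⟧ᶜ ρ = ⟦ φ ⟧ᶜ ρ × ⟦ ψ ⟧ᶜ ρ
  ⟦ ex φ ⟧ᶜ ρ = Σ (Dom n) λ d → ⟦ φ ⟧ᶜ (extend d ρ)

  ⟦_⟧ᶠ : FO k Rel v → (Fin v → Dom n) → Set
  ⟦ atom α ⟧ᶠ = ⟦ α ⟧ᵃ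
  ⟦ neg φ ⟧ᶠ ρ = ¬ ⟦ φ ⟧ᶠ ρ
  ⟦ and φ ψ ⟧ᶠ ρ = ⟦ φ ⟧ᶠ ρ × ⟦ ψ ⟧ᶠ ρ
  ⟦ or φ ψ ⟧ᶠ ρ = ⟦ φ ⟧ᶠ ρ ⊎ ⟦ ψ ⟧ᶠ ρ
  ⟦ ex φ ⟧ᶠ ρ = Σ (Dom n) λ d → ⟦ φ ⟧ᶠ (extend d ρ)
  ⟦ all φ ⟧ᶠ ρ = ∀ d → ⟦ φ ⟧ᶠ (extend d ρ)

  module Soundness (I : Interp Rel n) (I⇔M : ∀ {a} (r : Rel a) t → T (I r t) ⇔ M r t) where

    sameLetter-sound : ∀ x ζ → T (sameLetter (letter w x) ζ) ⇔ (letter w x ≡ just ζ)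
    sameLetter-sound x ζ with letter w x
    ... | nothing = mk⇔ (λ ()) (λ ())
    ... | just a = mk⇔ (cong just ∘ toWitness) (fromWitness ∘ just-injective)

    evalAtom-sound : ∀ (ρ : Fin v → Dom n) α → T (evalAtom w I ρ α) ⇔ ⟦ α ⟧ᵃ ρ
    evalAtom-sound ρ (eqA s t) = mk⇔ toWitness fromWitness
    evalAtom-sound ρ (ltA s t) = mk⇔ (<ᵇ⇒< _ _) <⇒<ᵇ
    evalAtom-sound ρ (symA ζ t) = sameLetter-sound (evalTerm ρ t) ζ
    evalAtom-sound ρ (auxA r ts) = I⇔M r _

    evalCQ-sound : ∀ (ρ : Fin v → Dom n) φ → T (evalCQ w I ρ φ) ⇔ ⟦ φ ⟧ᶜ ρ
    evalCQ-sound ρ (atom α) = evalAtom-sound ρ α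
    evalCQ-sound ρ (and φ ψ) = (evalCQ-sound ρ φ ×-⇔ evalCQ-sound ρ ψ) ⇔-∘ T-∧
    evalCQ-sound ρ (ex φ) =
      Σ-⇔ (↠-id _) (evalCQ-sound (extend _ ρ) φ) ⇔-∘ T-any-allFin _

    evalFO-sound : ∀ (ρ : Fin v → Dom n) φ → T (evalFO w I ρ φ) ⇔ ⟦ φ ⟧ᶠ ρ
    evalFO-sound ρ (atom α) = evalAtom-sound ρ α
    evalFO-sound ρ (neg φ) = ¬-cong-⇔ (evalFO-sound ρ φ) ⇔-∘ T-not
    evalFO-sound ρ (and φ ψ) = (evalFO-sound ρ φ ×-⇔ evalFO-sound ρ ψ) ⇔-∘ T-∧
    evalFO-sound ρ (or φ ψ) = (evalFO-sound ρ φ ⊎-⇔ evalFO-sound ρ ψ) ⇔-∘ T-∨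
    evalFO-sound ρ (ex φ) =
      Σ-⇔ (↠-id _) (evalFO-sound (extend _ ρ) φ) ⇔-∘ T-any-allFin _
    evalFO-sound ρ (all φ) =
      ∀-cong-⇔ (λ d → evalFO-sound (extend d ρ) φ) ⇔-∘ T-all-allFin _

-- Positions of symbols

sum-tabulate-mono : {f g : Fin n → ℕ} → (∀ i → f i ≤ℕ g i) → sum (tabulate f) ≤ℕ sum (tabulate g)
sum-tabulate-mono {n = 0} f≤g = z≤n
sum-tabulate-mono {n = suc n} f≤g = +-mono-≤ (f≤g zero) (sum-tabulate-mono (λ i → f≤g (suc i)))

sum-tabulate-mono-< : {f g : Fin n → ℕ} (i₀ : Fin n) → (∀ i → f i ≤ℕ g i) → f i₀ <ℕ g i₀ →
                      sum (tabulate f) <ℕ sum (tabulate g)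
sum-tabulate-mono-< zero f≤g f<g = +-mono-<-≤ f<g (sum-tabulate-mono (λ i → f≤g (suc i)))
sum-tabulate-mono-< (suc i₀) f≤g f<g =
  +-mono-≤-< (f≤g zero) (sum-tabulate-mono-< i₀ (λ i → f≤g (suc i)) f<g)

sum-tabulate-suc : {f g : Fin n → ℕ} (i₀ : Fin n) →
                   g i₀ ≡ suc (f i₀) → (∀ i → i ≢ i₀ → g i ≡ f i) →
                   sum (tabulate g) ≡ suc (sum (tabulate f))
sum-tabulate-suc zero g≡f+1 g≡f =
  cong₂ _+_ g≡f+1 (cong sum (tabulate-cong (λ i → g≡f (suc i) λ ())))
sum-tabulate-suc {f = f} (suc i₀) g≡f+1 g≡f =
  trans (cong₂ _+_ (g≡f zero λ ()) (sum-tabulate-suc i₀ g≡f+1 λ i i≢i₀ → g≡f (suc i) (i≢i₀ ∘ suc-injective)))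
        (+-suc (f zero) _)

symbol-or-blank : (w : Word k n) (x : Dom n) → IsSymbol w x ⊎ letter w x ≡ nothing
symbol-or-blank w x with letter w x
... | just _ = inj₁ λ ()
... | nothing = inj₂ refl

Gap : Word k n → Dom n → Dom n → Set
Gap w a b = ∀ z → a < z → z < b → letter w z ≡ nothing

symbolUpTo : Word k n → Dom n → Dom n → ℕ
symbolUpTo w x j = if (toℕ j ≤ᵇ toℕ x) ∧ is-just (letter w j) then 1 else 0

pos-tabulate : (w : Word k n) (x : Dom n) → pos w x ≡ sum (tabulate (symbolUpTo w x))
pos-tabulate w x = cong sum (map-tabulate id (symbolUpTo w x))

module _ (w : Word k n) where

  symbolUpTo-one : {x j : Dom n} → j ≤ x → IsSymbol w j → symbolUpTo w x j ≡ 1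
  symbolUpTo-one {x} {j} j≤x sym with toℕ j ≤ᵇ toℕ x | ≤ᵇ-reflects-≤ (toℕ j) (toℕ x) | letter w j
  ... | false | ofⁿ j≰x | _ = contradiction j≤x j≰x
  ... | true | _ | just _ = refl
  ... | true | _ | nothing = contradiction refl sym

  symbolUpTo-zero : {x j : Dom n} → (j ≤ x → letter w j ≡ nothing) → symbolUpTo w x j ≡ 0
  symbolUpTo-zero {x} {j} blank with toℕ j ≤ᵇ toℕ x | ≤ᵇ-reflects-≤ (toℕ j) (toℕ x)
  ... | false | _ = refl
  ... | true | ofʸ j≤x rewrite blank j≤x = refl

  symbolUpTo-mono : {x y : Dom n} → x ≤ y → ∀ j → symbolUpTo w x j ≤ℕ symbolUpTo w y j
  symbolUpTo-mono {x} {y} x≤y j with toℕ j ≤ℕ? toℕ x | symbol-or-blank w j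
  ... | yes j≤x | inj₁ sym
    rewrite symbolUpTo-one j≤x sym | symbolUpTo-one {y} (≤-trans j≤x x≤y) sym = ≤-refl
  ... | yes _ | inj₂ blank rewrite symbolUpTo-zero {x} λ _ → blank = z≤n
  ... | no j≰x | _ rewrite symbolUpTo-zero {x} {j} λ j≤x → contradiction j≤x j≰x = z≤n

  symbolUpTo-outside : {x y : Dom n} → x < y → Gap w x y →
                       ∀ j → j ≢ y → symbolUpTo w y j ≡ symbolUpTo w x j
  symbolUpTo-outside {x} {y} x<y gap j j≢y with symbol-or-blank w j
  ... | inj₂ blank = trans (symbolUpTo-zero λ _ → blank) (sym (symbolUpTo-zero λ _ → blank))
  ... | inj₁ symbol with toℕ j ≤ℕ? toℕ x
  ...   | yes j≤x = trans (symbolUpTo-one (≤-trans j≤x (<⇒≤ x<y)) symbol) (sym (symbolUpTo-one j≤x symbol))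
  ...   | no j≰x with <-cmp j y
  ...     | tri< j<y _ _ = contradiction (gap j (≰⇒> j≰x) j<y) symbol
  ...     | tri≈ _ j≡y _ = contradiction j≡y j≢y
  ...     | tri> _ _ y<j = trans (symbolUpTo-zero λ j≤y → contradiction j≤y (<⇒≱ y<j))
                                 (sym (symbolUpTo-zero λ j≤x → contradiction j≤x j≰x))

  symbolUpTo-jump : {x y : Dom n} → x < y → IsSymbol w y → symbolUpTo w y y ≡ suc (symbolUpTo w x y)
  symbolUpTo-jump x<y symbol =
    trans (symbolUpTo-one ≤-refl symbol)
          (cong suc (sym (symbolUpTo-zero λ y≤x → contradiction y≤x (<⇒≱ x<y))))

  pos-mono : {x y : Dom n} → x ≤ y → pos w x ≤ℕ pos w y
  pos-mono {x} {y} x≤y rewrite pos-tabulate w x | pos-tabulate w y = sum-tabulate-mono (symbolUpTo-mono x≤y)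

  pos-mono-< : {x y : Dom n} → x < y → IsSymbol w y → pos w x <ℕ pos w y
  pos-mono-< {x} {y} x<y symbol rewrite pos-tabulate w x | pos-tabulate w y =
    sum-tabulate-mono-< y (symbolUpTo-mono (<⇒≤ x<y)) (≤-reflexive (sym (symbolUpTo-jump x<y symbol)))

  pos-suc : {x y : Dom n} → x < y → IsSymbol w y → Gap w x y → pos w y ≡ suc (pos w x)
  pos-suc {x} {y} x<y symbol gap rewrite pos-tabulate w x | pos-tabulate w y =
    sum-tabulate-suc y (symbolUpTo-jump x<y symbol) (symbolUpTo-outside x<y gap)

  Next⇔ : {x y : Dom n} → Next w x y ⇔ (x < y × IsSymbol w x × IsSymbol w y × Gap w x y)
  Next⇔ {x} {y} = mk⇔ to from
    where
    to : Next w x y → x < y × IsSymbol w x × IsSymbol w y × Gap w x y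
    to (sx , sy , pos≡) = x<y , sx , sy , gap
      where
      pos-x<pos-y : pos w x <ℕ pos w y
      pos-x<pos-y = ≤-reflexive (sym pos≡)
      x<y : x < y
      x<y = ≰⇒> λ y≤x → <⇒≱ pos-x<pos-y (pos-mono y≤x)
      gap : Gap w x y
      gap z x<z z<y with symbol-or-blank w z
      ... | inj₂ blank = blank
      ... | inj₁ sz = contradiction (≤-pred (subst (pos w z <ℕ_) pos≡ (pos-mono-< z<y sy)))
                                    (<⇒≱ (pos-mono-< x<z sz))
    from : x < y × IsSymbol w x × IsSymbol w y × Gap w x y → Next w x y
    from (x<y , sx , sy , gap) = sx , sy , pos-suc x<y sy gap

-- Changing a single letter

letter-[]≔-updated : (w : Word k n) (i : Fin n) (a : Maybe (Fin k)) → letter (w [ i ]≔ a) (inject₁ i) ≡ a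
letter-[]≔-updated (_ ∷ _) zero a = refl
letter-[]≔-updated (_ ∷ w) (suc i) a = letter-[]≔-updated w i a

letter-[]≔-unchanged : (w : Word k n) (i : Fin n) (a : Maybe (Fin k)) (x : Dom n) → x ≢ inject₁ i →
                       letter (w [ i ]≔ a) x ≡ letter w x
letter-[]≔-unchanged (_ ∷ _) zero a zero x≢i = contradiction refl x≢i
letter-[]≔-unchanged (_ ∷ _) zero a (suc x) x≢i = refl
letter-[]≔-unchanged (_ ∷ _) (suc i) a zero x≢i = refl
letter-[]≔-unchanged (_ ∷ w) (suc i) a (suc x) x≢i = letter-[]≔-unchanged w i a x (x≢i ∘ cong suc)

letter-emptyWord : ∀ n (x : Dom n) → letter (emptyWord {k} n) x ≡ nothing
letter-emptyWord 0 x = refl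
letter-emptyWord (suc n) zero = refl
letter-emptyWord (suc n) (suc x) = letter-emptyWord n x

SymbolOrEq : Word k n → Dom n → Dom n → Set
SymbolOrEq w x z = IsSymbol w x ⊎ x ≡ z

NotBetween : Dom n → Dom n → Dom n → Set
NotBetween a c b = ¬ (a < c × c < b)

EqEither : Dom n → Dom n → Dom n → Set
EqEither u c z = u ≡ c ⊎ u ≡ z

NeqOrEq : Dom n → Dom n → Dom n → Set
NeqOrEq x c z = x ≢ c ⊎ x ≡ z

module SingleChange (w w′ : Word k n) {c : Dom n}
                    (unchanged : ∀ x → x ≢ c → letter w′ x ≡ letter w x) where

  IsSymbol-unchanged : ∀ {x} → x ≢ c → IsSymbol w′ x ⇔ IsSymbol w x
  IsSymbol-unchanged x≢c =
    mk⇔ (λ sx′ → sx′ ∘ trans (unchanged _ x≢c)) (λ sx → sx ∘ trans (sym (unchanged _ x≢c)))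

  Gap-insert : ∀ {a b} → IsSymbol w′ c → Gap w′ a b ⇔ (Gap w a b × NotBetween a c b)
  Gap-insert {a} {b} sc = mk⇔ to from
    where
    to : Gap w′ a b → Gap w a b × NotBetween a c b
    to gap′ = (λ z a<z z<b → trans (sym (unchanged z λ { refl → sc (gap′ z a<z z<b) })) (gap′ z a<z z<b))
            , λ (a<c , c<b) → sc (gap′ c a<c c<b)
    from : Gap w a b × NotBetween a c b → Gap w′ a b
    from (gap , c∉) z a<z z<b with z ≟ᶠ c
    ... | yes refl = contradiction (a<z , z<b) c∉
    ... | no z≢c = trans (unchanged z z≢c) (gap z a<z z<b)

  -- Gap w a a holds trivially, so p = a covers the case that c is not strictly between a and b.
  Gap-delete : ∀ {a b} → letter w′ c ≡ nothing →
               Gap w′ a b ⇔ ∃ λ p → Gap w a p × Gap w p b × EqEither p c a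
  Gap-delete {a} {b} blank = mk⇔ to from
    where
    to : Gap w′ a b → ∃ λ p → Gap w a p × Gap w p b × EqEither p c a
    to gap′ with (a <? c) ×-dec (c <? b)
    ... | yes (a<c , c<b) =
      c , (λ z a<z z<c → old z a<z (<-trans z<c c<b) (<⇒≢ z<c))
        , (λ z c<z z<b → old z (<-trans a<c c<z) z<b (≢-sym (<⇒≢ c<z)))
        , inj₁ refl
      where
      old : ∀ z → a < z → z < b → z ≢ c → letter w z ≡ nothing
      old z a<z z<b z≢c = trans (sym (unchanged z z≢c)) (gap′ z a<z z<b)
    ... | no c∉ =
      a , (λ z a<z z<a → contradiction z<a (<-asym a<z))
        , (λ z a<z z<b → trans (sym (unchanged z λ { refl → c∉ (a<z , z<b) })) (gap′ z a<z z<b))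
        , inj₂ refl
    blank-except-c : ∃ (λ p → Gap w a p × Gap w p b × EqEither p c a) →
                     ∀ z → a < z → z < b → z ≢ c → letter w z ≡ nothing
    blank-except-c (p , gap-ap , gap-pb , inj₂ refl) z a<z z<b _ = gap-pb z a<z z<b
    blank-except-c (p , gap-ap , gap-pb , inj₁ refl) z a<z z<b z≢c with <-cmp z c
    ... | tri< z<c _ _ = gap-ap z a<z z<c
    ... | tri≈ _ z≡c _ = contradiction z≡c z≢c
    ... | tri> _ _ c<z = gap-pb z c<z z<b
    from : ∃ (λ p → Gap w a p × Gap w p b × EqEither p c a) → Gap w′ a b
    from split z a<z z<b with z ≟ᶠ c
    ... | yes refl = blank
    ... | no z≢c = trans (unchanged z z≢c) (blank-except-c split z a<z z<b z≢c)

  SymbolOrEq-insert : ∀ {x z} → IsSymbol w′ c →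
                      SymbolOrEq w′ x z ⇔ ∃ λ d → SymbolOrEq w x d × EqEither d c z
  SymbolOrEq-insert {x} {z} sc = mk⇔ to from
    where
    to : SymbolOrEq w′ x z → ∃ λ d → SymbolOrEq w x d × EqEither d c z
    to (inj₁ sx′) with x ≟ᶠ c
    ... | yes x≡c = c , inj₂ x≡c , inj₁ refl
    ... | no x≢c = z , inj₁ (Equivalence.to (IsSymbol-unchanged x≢c) sx′) , inj₂ refl
    to (inj₂ x≡z) = z , inj₂ x≡z , inj₂ refl
    from : (∃ λ d → SymbolOrEq w x d × EqEither d c z) → SymbolOrEq w′ x z
    from (_ , inj₂ refl , inj₁ refl) = inj₁ sc
    from (_ , inj₂ refl , inj₂ refl) = inj₂ refl
    from (_ , inj₁ sx , _) with x ≟ᶠ c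
    ... | yes refl = inj₁ sc
    ... | no x≢c = inj₁ (Equivalence.from (IsSymbol-unchanged x≢c) sx)

  SymbolOrEq-delete : ∀ {x z} → letter w′ c ≡ nothing →
                      SymbolOrEq w′ x z ⇔ (SymbolOrEq w x z × NeqOrEq x c z)
  SymbolOrEq-delete {x} {z} blank = mk⇔ to from
    where
    to : SymbolOrEq w′ x z → SymbolOrEq w x z × NeqOrEq x c z
    to (inj₁ sx′) = inj₁ (Equivalence.to (IsSymbol-unchanged x≢c) sx′) , inj₁ x≢c
      where
      x≢c : x ≢ c
      x≢c refl = sx′ blank
    to (inj₂ x≡z) = inj₂ x≡z , inj₂ x≡z
    from : SymbolOrEq w x z × NeqOrEq x c z → SymbolOrEq w′ x z
    from (_ , inj₂ x≡z) = inj₂ x≡z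
    from (inj₂ x≡z , _) = inj₂ x≡z
    from (inj₁ sx , inj₁ x≢c) = inj₁ (Equivalence.from (IsSymbol-unchanged x≢c) sx)

pattern next = zero
pattern symbolOrEq = suc zero
pattern gap = suc (suc zero)
pattern notBetween = suc (suc (suc zero))
pattern eqEither = suc (suc (suc (suc zero)))
pattern neqOrEq = suc (suc (suc (suc (suc zero))))

arity : Fin 6 → ℕ
arity next = 2
arity symbolOrEq = 2
arity gap = 2
arity notBetween = 3
arity eqEither = 3
arity neqOrEq = 3

Meaning : Word k n → (r : Fin 6) → Vec (Dom n) (arity r) → Set
Meaning w next (x ∷ y ∷ []) = Next w x y
Meaning w symbolOrEq (x ∷ z ∷ []) = SymbolOrEq w x z
Meaning w gap (a ∷ b ∷ []) = Gap w a b
Meaning w notBetween (a ∷ c ∷ b ∷ []) = NotBetween a c b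
Meaning w eqEither (u ∷ c ∷ z ∷ []) = EqEither u c z
Meaning w neqOrEq (x ∷ c ∷ z ∷ []) = NeqOrEq x c z

Next⇔SymbolOrEq : {w : Word k n} {x y : Dom n} →
                  Next w x y ⇔ (x < y × SymbolOrEq w x y × SymbolOrEq w y x × Gap w x y)
Next⇔SymbolOrEq {w = w} {x} {y} = mk⇔ to from
  where
  to : Next w x y → x < y × SymbolOrEq w x y × SymbolOrEq w y x × Gap w x y
  to nxt = let x<y , sx , sy , g = Equivalence.to (Next⇔ w) nxt in x<y , inj₁ sx , inj₁ sy , g
  from : x < y × SymbolOrEq w x y × SymbolOrEq w y x × Gap w x y → Next w x y
  from (x<y , inj₁ sx , inj₁ sy , g) = Equivalence.from (Next⇔ w) (x<y , sx , sy , g)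
  from (x<y , inj₂ refl , _ , _) = contradiction x<y (<-irrefl refl)
  from (x<y , _ , inj₂ refl , _) = contradiction x<y (<-irrefl refl)

Formula : ℕ → ℕ → Set
Formula k = CQ k (RelOf arity)

rel : (r : Fin 6) → Vec (Term v) (arity r) → Formula k v
rel r ts = atom (auxA (r , refl) ts)

-- In the update formulas variable zero is the updated position, so every other variable is shifted.
shiftedVars : Vec (Term (suc v)) v
shiftedVars = tabulateᵛ (var ∘ suc)

symbolOrEqUpd : Op k → Fin v → Fin v → Formula k (suc v)
symbolOrEqUpd (insOp _) x z =
  ex (and (rel symbolOrEq (var (suc (suc x)) ∷ var zero ∷ []))
          (rel eqEither (var zero ∷ var (suc zero) ∷ var (suc (suc z)) ∷ [])))
symbolOrEqUpd resetOp x z =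
  and (rel symbolOrEq (var (suc x) ∷ var (suc z) ∷ []))
      (rel neqOrEq (var (suc x) ∷ var zero ∷ var (suc z) ∷ []))

gapUpd : Op k → Fin v → Fin v → Formula k (suc v)
gapUpd (insOp _) a b =
  and (rel gap (var (suc a) ∷ var (suc b) ∷ []))
      (rel notBetween (var (suc a) ∷ var zero ∷ var (suc b) ∷ []))
gapUpd resetOp a b =
  ex (and (rel gap (var (suc (suc a)) ∷ var zero ∷ []))
     (and (rel gap (var zero ∷ var (suc (suc b)) ∷ []))
          (rel eqEither (var zero ∷ var (suc zero) ∷ var (suc (suc a)) ∷ []))))

nextUpd : Op k → Fin v → Fin v → Formula k (suc v)
nextUpd op x y =
  and (atom (ltA (var (suc x)) (var (suc y))))
  (and (symbolOrEqUpd op x y) (and (symbolOrEqUpd op y x) (gapUpd op x y)))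

updateFormula : (r : Fin 6) → Op k → Formula k (suc (arity r))
updateFormula next op = nextUpd op zero (suc zero)
updateFormula symbolOrEq op = symbolOrEqUpd op zero (suc zero)
updateFormula gap op = gapUpd op zero (suc zero)
updateFormula notBetween _ = rel notBetween shiftedVars
updateFormula eqEither _ = rel eqEither shiftedVars
updateFormula neqOrEq _ = rel neqOrEq shiftedVars

eqᶠ ltᶠ : Fin v → Fin v → FO k NoRel v
eqᶠ a b = atom (eqA (var a) (var b))
ltᶠ a b = atom (ltA (var a) (var b))

initFormula : (r : Fin 6) → FO k NoRel (arity r)
initFormula next = neg (eqᶠ zero zero)
initFormula symbolOrEq = eqᶠ zero (suc zero)
initFormula gap = eqᶠ zero zero
initFormula notBetween = neg (and (ltᶠ zero (suc zero)) (ltᶠ (suc zero) (suc (suc zero))))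
initFormula eqEither = or (eqᶠ zero (suc zero)) (eqᶠ zero (suc (suc zero)))
initFormula neqOrEq = or (neg (eqᶠ zero (suc zero))) (eqᶠ zero (suc (suc zero)))

program : DynCQProgram k
program = record { m = 6 ; arity = arity ; init = initFormula ; update = updateFormula }

data Change (w′ : Word k n) (c : Dom n) : Op k → Set where
  inserted : ∀ {ζ} → IsSymbol w′ c → Change w′ c (insOp ζ)
  deleted : letter w′ c ≡ nothing → Change w′ c resetOp

update-change : (w : Word k n) (u : Update k n) → Change (applyWord u w) (argOf u) (opOf u)
update-change w (ins ζ i) =
  inserted λ blank → contradiction (trans (sym (letter-[]≔-updated w i (just ζ))) blank) λ ()
update-change w (reset i) = deleted (letter-[]≔-updated w i nothing)

update-unchanged : (w : Word k n) (u : Update k n) →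
                   ∀ x → x ≢ argOf u → letter (applyWord u w) x ≡ letter w x
update-unchanged w (ins ζ i) = letter-[]≔-unchanged w i (just ζ)
update-unchanged w (reset i) = letter-[]≔-unchanged w i nothing

meaningInterp : Word k n → RelSemantics (RelOf arity) n
meaningInterp w (r , refl) t = Meaning w r t

module UpdateCorrect (w w′ : Word k n) {c : Dom n}
                     (unchanged : ∀ x → x ≢ c → letter w′ x ≡ letter w x) where
  open Semantics w′ (meaningInterp w)
  open SingleChange w w′ unchanged

  symbolOrEqUpd-correct : ∀ {op} → Change w′ c op → (ρ : Fin v → Dom n) (x z : Fin v) →
                          ⟦ symbolOrEqUpd op x z ⟧ᶜ (extend c ρ) ⇔ SymbolOrEq w′ (ρ x) (ρ z)
  symbolOrEqUpd-correct (inserted sc) ρ x z = ⇔-sym (SymbolOrEq-insert sc)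
  symbolOrEqUpd-correct (deleted blank) ρ x z = ⇔-sym (SymbolOrEq-delete blank)

  gapUpd-correct : ∀ {op} → Change w′ c op → (ρ : Fin v → Dom n) (a b : Fin v) →
                   ⟦ gapUpd op a b ⟧ᶜ (extend c ρ) ⇔ Gap w′ (ρ a) (ρ b)
  gapUpd-correct (inserted sc) ρ a b = ⇔-sym (Gap-insert sc)
  gapUpd-correct (deleted blank) ρ a b = ⇔-sym (Gap-delete blank)

  nextUpd-correct : ∀ {op} → Change w′ c op → (ρ : Fin v → Dom n) (x y : Fin v) →
                    ⟦ nextUpd op x y ⟧ᶜ (extend c ρ) ⇔ Next w′ (ρ x) (ρ y)
  nextUpd-correct ch ρ x y =
    ⇔-sym (Next⇔SymbolOrEq {w = w′}) ⇔-∘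
      (⇔-id _ ×-⇔ symbolOrEqUpd-correct ch ρ x y ×-⇔ symbolOrEqUpd-correct ch ρ y x ×-⇔
       gapUpd-correct ch ρ x y)

  updateFormula-correct : ∀ {op} → Change w′ c op → (r : Fin 6) (t : Vec (Dom n) (arity r)) →
                          ⟦ updateFormula r op ⟧ᶜ (extend c (lookup t)) ⇔ Meaning w′ r t
  updateFormula-correct ch next t@(_ ∷ _ ∷ []) = nextUpd-correct ch (lookup t) zero (suc zero)
  updateFormula-correct ch symbolOrEq t@(_ ∷ _ ∷ []) = symbolOrEqUpd-correct ch (lookup t) zero (suc zero)
  updateFormula-correct ch gap t@(_ ∷ _ ∷ []) = gapUpd-correct ch (lookup t) zero (suc zero)
  updateFormula-correct ch notBetween (_ ∷ _ ∷ _ ∷ []) = ⇔-id _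
  updateFormula-correct ch eqEither (_ ∷ _ ∷ _ ∷ []) = ⇔-id _
  updateFormula-correct ch neqOrEq (_ ∷ _ ∷ _ ∷ []) = ⇔-id _

noSemantics : RelSemantics NoRel n
noSemantics ()

initFormula-correct : (r : Fin 6) (t : Vec (Dom n) (arity r)) →
                      Semantics.⟦_⟧ᶠ (emptyWord {k} n) noSemantics (initFormula r) (lookup t) ⇔
                      Meaning (emptyWord {k} n) r t
initFormula-correct {n} next (x ∷ y ∷ []) =
  mk⇔ (λ x≢x → contradiction refl x≢x) (λ (sx , _) → contradiction (letter-emptyWord n x) sx)
initFormula-correct {n} symbolOrEq (x ∷ z ∷ []) =
  mk⇔ inj₂ [ (λ sx → contradiction (letter-emptyWord n x) sx) , id ]
initFormula-correct {n} gap (a ∷ b ∷ []) = mk⇔ (λ _ z _ _ → letter-emptyWord n z) (λ _ → refl)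
initFormula-correct notBetween (_ ∷ _ ∷ _ ∷ []) = ⇔-id _
initFormula-correct eqEither (_ ∷ _ ∷ _ ∷ []) = ⇔-id _
initFormula-correct neqOrEq (_ ∷ _ ∷ _ ∷ []) = ⇔-id _

Invariant : State (program {k}) n → Set
Invariant (w , S) = ∀ r t → T (S r t) ⇔ Meaning w r t

init-invariant : ∀ n → Invariant (initState (program {k}) n)
init-invariant {k} n r t = initFormula-correct {k = k} r t ⇔-∘ evalFO-sound (lookup t) (initFormula r)
  where open Semantics (emptyWord n) noSemantics
        open Soundness noInterp (λ ())

asInterp-sound : {w : Word k n} {S : AuxState (program {k}) n} → (∀ r t → T (S r t) ⇔ Meaning w r t) →
                 ∀ {a} (r : RelOf arity a) t → T (asInterp (program {k}) S r t) ⇔ meaningInterp w r t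
asInterp-sound S⇔Meaning (r , refl) t = S⇔Meaning r t

step-invariant : {s : State (program {k}) n} (u : Update k n) → Invariant s → Invariant (step program s u)
step-invariant {k} {s = w , S} u inv r t =
  updateFormula-correct (update-change w u) r t ⇔-∘
  evalCQ-sound (extend (argOf u) (lookup t)) (updateFormula r (opOf u))
  where open UpdateCorrect w (applyWord u w) (update-unchanged w u)
        open Semantics (applyWord u w) (meaningInterp w)
        open Soundness (asInterp (program {k}) S) (asInterp-sound inv)

run-invariant : (us : List (Update k n)) {s : State program n} → Invariant s → Invariant (run program s us)
run-invariant [] inv = inv
run-invariant (u ∷ us) inv = run-invariant us (step-invariant u inv)

lemma3p3 : (k : ℕ) → Σ (DynCQProgram k) (λ P → Σ (Fin (DynCQProgram.m P)) (λ r → Σ (DynCQProgram.arity P r ≡ 2) (λ p → MaintainsNext P r p)))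
-- The program is correct after every update sequence, so the hypothesis that updates are allowed is unused.
lemma3p3 k = program , next , refl , λ n us _ x y → run-invariant us (init-invariant n) next (x ∷ y ∷ [])
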